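{- Let $V$ be a finite set, let $\sigma=(\sigma_1,\ldots,\sigma_r)$ be an ordered set partition of $V$, and let $G$ be a graph on $V$ anchored by $\sigma_1$. Then the following are equivalent: (i) $j_{\sigma_1}(G)=\sigma$; (ii) the edge set of $G$ is the union of the members of two families $(A_i)_{i=1}^r$ and $(B_w)_{w\in V\setminus\sigma_1}$, where each $A_i$ is a (possibly empty) set of edges with both ends in $\sigma_i$, and each $B_w$ is a nonempty set of edges each joining $w$ to a vertex of $\sigma_{s-1}$, where $\sigma_s$ is the block of $\sigma$ containing $w$.
   Context: Graphs are simple undirected graphs. For $S\subseteq V$, a graph $G$ on $V$ is anchored by $S$ if every vertex of $V$ is joined by a path in $G$ to some element of $S$. For such $G$, $j_S(G)$ is the ordered set partition $(\sigma_1,\sigma_2,\ldots)$ defined by $\sigma_1=S$ and, as long as $\sigma_1\cup\cdots\cup\sigma_k\neq V$, $\sigma_{k+1}$ is the set of vertices of $V\setminus(\sigma_1\cup\cdots\cup\sigma_k)$ adjacent to some element of $\sigma_k$. -}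

module Defs where

open import Level using (0ℓ)
open import Data.Nat using (ℕ; zero; suc; _<_)
open import Data.Fin using (Fin; toℕ; inject₁) renaming (zero to fzero; suc to fsuc)
open import Data.Product using (Σ; ∃; ∃-syntax; _×_; _,_)
open import Data.Sum using (_⊎_)
open import Relation.Nullary using (¬_)
open import Relation.Unary using (Pred)
open import Relation.Binary.PropositionalEquality using (_≡_; _≢_)
open import Relation.Binary.Construct.Closure.ReflexiveTransitive using (Star)
open import Function.Bundles using (_⇔_)

record Graph (n : ℕ) : Set₁ where
  field
    Adj   : Fin n → Fin n → Set
    sym   : ∀ {u v} → Adj u v → Adj v u
    irrefl : ∀ {u} → ¬ Adj u u
open Graph public

Connected : ∀ {n} → Graph n → Fin n → Fin n → Set
Connected G = Star (Adj G)

Anchored : ∀ {n} → Graph n → Pred (Fin n) 0ℓ → Set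
Anchored {n} G S = (v : Fin n) → ∃[ u ] (S u × Connected G v u)

-- The layers of j_S(G), indexed from 0 (Layer 0 = σ_1 = S), together with
-- their running unions Upto k = Layer 0 ∪ ... ∪ Layer k.
mutual
  Layer : ∀ {n} → Graph n → Pred (Fin n) 0ℓ → ℕ → Pred (Fin n) 0ℓ
  Layer G S zero v = S v
  Layer G S (suc k) v = ¬ Upto G S k v × ∃[ u ] (Layer G S k u × Adj G u v)

  Upto : ∀ {n} → Graph n → Pred (Fin n) 0ℓ → ℕ → Pred (Fin n) 0ℓ
  Upto G S zero v = Layer G S zero v
  Upto G S (suc k) v = Upto G S k v ⊎ Layer G S (suc k) v

-- An ordered set partition (σ_1,…,σ_{k+1}) of V = Fin n is encoded by the
-- block-assignment map blk : Fin n → Fin (suc k), σ_{i+1} = {v ∣ blk v ≡ i},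
-- required to be surjective (blocks nonempty).
Block : ∀ {n k} → (Fin n → Fin (suc k)) → Fin (suc k) → Pred (Fin n) 0ℓ
Block blk i v = blk v ≡ i

IsOrderedPartition : ∀ {n k} → (Fin n → Fin (suc k)) → Set
IsOrderedPartition {n} {k} blk = (i : Fin (suc k)) → ∃[ v ] (blk v ≡ i)

-- j_S(G) = σ : the sequence j_S(G) has exactly k+1 terms (the process stops
-- right after the (k+1)-st layer, i.e. the union of the first k+1 layers is V
-- and no shorter union is V) and its (i+1)-st term equals σ_{i+1}.
JEq : ∀ {n k} → Graph n → Pred (Fin n) 0ℓ → (Fin n → Fin (suc k)) → Set
JEq {n} {k} G S blk =
    ((i : Fin (suc k)) (v : Fin n) → Layer G S (toℕ i) v ⇔ Block blk i v)
  × ((v : Fin n) → Upto G S k v)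
  × ((m : ℕ) → m < k → ¬ ((v : Fin n) → Upto G S m v))

-- A set of edges: the edge {u,v} belongs to X iff X u v or X v u.
EdgeSet : ℕ → Set₁
EdgeSet n = Fin n → Fin n → Set

_∋ₑ_—_ : ∀ {n} → EdgeSet n → Fin n → Fin n → Set
X ∋ₑ u — v = X u v ⊎ X v u

CondII : ∀ {n k} → Graph n → (Fin n → Fin (suc k)) → Set₁
CondII {n} {k} G blk =
  Σ (Fin (suc k) → EdgeSet n) λ A →
  Σ (Fin n → EdgeSet n) λ B →
      ((u v : Fin n) → Adj G u v ⇔
          ((∃[ i ] (A i ∋ₑ u — v)) ⊎ (∃[ w ] (blk w ≢ fzero × (B w ∋ₑ u — v)))))
    × ((i : Fin (suc k)) (u v : Fin n) → A i u v → blk u ≡ i × blk v ≡ i)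
      -- for w ∈ σ_s, s ≥ 2 : B_w nonempty, each edge joins w to σ_{s-1}
    × ((w : Fin n) (j : Fin k) → blk w ≡ fsuc j →
          (∃[ u ] ∃[ v ] B w u v)
        × ((u v : Fin n) → B w u v →
              (u ≡ w × blk v ≡ inject₁ j) ⊎ (v ≡ w × blk u ≡ inject₁ j)))

module Submission where

-- Proposition 4.1: for an ordered set partition σ of V given by the block map
-- blk, both conditions (i) j_{σ₁}(G) = σ and (ii) the A/B edge decomposition
-- are equivalent to one intermediate condition on the level function
-- level v = index of the block of v:
--
--   G is graded by level:  adjacent vertices have levels differing by at most
--   one (Lipschitz), and every vertex of level s+1 has a neighbour of level s
--   (HasParents).
--
-- Specialised to h = level, this gives (i) ⇔ graded (JEq⇔Graded); the
-- surjectivity of blk is used only to see that the process does not stop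
-- early.  Separately, (ii) ⇔ graded (CondII⇔Graded): an A-edge stays in one
-- block and a B-edge goes one block down, and conversely the edges inside
-- blocks and the edges to the previous block form such a decomposition.
-- The theorem is the composite of these two equivalences.

open import Defs
open import Data.Nat using (ℕ; zero; suc; _≤_; _<_; _≤′_; ≤′-refl; ≤′-step; z≤n; s≤s; s≤s⁻¹)
open import Data.Nat.Properties
  using (≤-refl; ≤-reflexive; ≤-trans; ≤-antisym; n≤1+n; m≤n⇒m≤1+n; <⇒≤; <⇒≱; ≰⇒>; ≮⇒≥;
         ≤⇒≤′; 1+n≰n; n≤0⇒n≡0; 0≢1+n; suc-injective; <-cmp; m<1+n⇒m<n∨m≡n; _<?_)
open import Data.Fin using (Fin; toℕ; inject₁; fromℕ; fromℕ<) renaming (zero to fzero; suc to fsuc)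
open import Data.Fin.Properties using (toℕ-injective; toℕ-inject₁; toℕ-fromℕ; toℕ-fromℕ<; toℕ≤pred[n])
open import Data.Product using (∃-syntax; _×_; _,_; proj₁; proj₂; swap)
open import Data.Sum using (_⊎_; inj₁; inj₂)
open import Data.Empty using (⊥-elim)
open import Relation.Nullary using (¬_; yes; no)
open import Relation.Binary using (tri<; tri≈; tri>)
open import Relation.Binary.PropositionalEquality
  using (_≡_; _≢_; refl; trans; cong; subst) renaming (sym to ≡-sym)
open import Function.Bundles using (_⇔_; mk⇔; Equivalence)
open import Function.Construct.Composition using (_⇔-∘_)
open import Function.Construct.Symmetry using (⇔-sym)

open Equivalence using (to; from)

Lipschitz : ∀ {n} → Graph n → (Fin n → ℕ) → Set
Lipschitz G h = ∀ {u v} → Adj G u v → h v ≤ suc (h u)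

HasParents : ∀ {n} → Graph n → (Fin n → ℕ) → Set
HasParents G h = ∀ {v m} → h v ≡ suc m → ∃[ u ] (Adj G u v × h u ≡ m)

Graded : ∀ {n} → Graph n → (Fin n → ℕ) → Set
Graded G h = Lipschitz G h × HasParents G h

Near : ℕ → ℕ → Set
Near a b = b ≤ suc a × a ≤ suc b

one-apart : ∀ {a b} → a ≡ suc b → Near a b
one-apart a≡1+b = m≤n⇒m≤1+n (≤-trans (n≤1+n _) (≤-reflexive (≡-sym a≡1+b))) , ≤-reflexive a≡1+b

equal-near : ∀ {a b} → a ≡ b → Near a b
equal-near a≡b = m≤n⇒m≤1+n (≤-reflexive (≡-sym a≡b)) , m≤n⇒m≤1+n (≤-reflexive a≡b)

Fin-nonzero : ∀ {k} (x : Fin (suc k)) → x ≢ fzero → ∃[ j ] (x ≡ fsuc j)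
Fin-nonzero fzero x≢0 = ⊥-elim (x≢0 refl)
Fin-nonzero (fsuc j) _ = j , refl

toℕ-suc : ∀ {k m} (x : Fin (suc k)) → toℕ x ≡ suc m → ∃[ j ] (x ≡ fsuc j × toℕ j ≡ m)
toℕ-suc (fsuc j) toℕx≡1+m = j , refl , suc-injective toℕx≡1+m

≡inject₁⇔toℕ : ∀ {k} {x : Fin (suc k)} {j : Fin k} → x ≡ inject₁ j ⇔ toℕ x ≡ toℕ j
≡inject₁⇔toℕ {j = j} =
  mk⇔ (λ x≡j → trans (cong toℕ x≡j) (toℕ-inject₁ j))
      (λ x≡j → toℕ-injective (trans x≡j (≡-sym (toℕ-inject₁ j))))

module Layers {n : ℕ} (G : Graph n) (S : Fin n → Set) where

  upto⇒layer : ∀ {m v} → Upto G S m v → ∃[ i ] (i ≤ m × Layer G S i v)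
  upto⇒layer {zero} p = 0 , z≤n , p
  upto⇒layer {suc m} (inj₁ p) with upto⇒layer p
  ... | i , i≤m , l = i , m≤n⇒m≤1+n i≤m , l
  upto⇒layer {suc m} (inj₂ l) = suc m , ≤-refl , l

  upto-mono : ∀ {m m′ v} → m ≤′ m′ → Upto G S m v → Upto G S m′ v
  upto-mono ≤′-refl p = p
  upto-mono (≤′-step m≤m′) p = inj₁ (upto-mono m≤m′ p)

module LayersOfGrading {n : ℕ} (G : Graph n) (S : Fin n → Set) (h : Fin n → ℕ)
                       (root : ∀ v → S v ⇔ h v ≡ 0) (graded : Graded G h) where

  LayerIsLevel UptoIsBelow : ℕ → Set
  LayerIsLevel m = ∀ v → Layer G S m v ⇔ h v ≡ m
  UptoIsBelow m = ∀ v → Upto G S m v ⇔ h v ≤ m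

  -- A vertex first reached at step m+1 sits at level m+1: its level is at
  -- most m+1 by Lipschitz and above m since it was not reached before;
  -- conversely its parent witnesses that it is reached at step m+1.
  layer-step : ∀ {m} → LayerIsLevel m → UptoIsBelow m → LayerIsLevel (suc m)
  layer-step {m} layer-m upto-m v = mk⇔ level-of-layer layer-of-level
    where
      level-of-layer : Layer G S (suc m) v → h v ≡ suc m
      level-of-layer (new , u , u∈layer , u—v) =
        ≤-antisym (subst (λ x → h v ≤ suc x) (to (layer-m u) u∈layer) (proj₁ graded u—v))
                  (≰⇒> (λ hv≤m → new (from (upto-m v) hv≤m)))
      layer-of-level : h v ≡ suc m → Layer G S (suc m) v
      layer-of-level hv≡1+m with proj₂ graded hv≡1+m
      ... | u , u—v , hu≡m =
        (λ old → 1+n≰n (subst (_≤ m) hv≡1+m (to (upto-m v) old))) , u , from (layer-m u) hu≡m , u—v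

  upto-step : ∀ {m} → UptoIsBelow m → LayerIsLevel (suc m) → UptoIsBelow (suc m)
  upto-step {m} upto-m layer-1+m v = mk⇔ below reached
    where
      below : Upto G S (suc m) v → h v ≤ suc m
      below (inj₁ old) = m≤n⇒m≤1+n (to (upto-m v) old)
      below (inj₂ new) = ≤-reflexive (to (layer-1+m v) new)
      reached : h v ≤ suc m → Upto G S (suc m) v
      reached hv≤1+m with m<1+n⇒m<n∨m≡n (s≤s hv≤1+m)
      ... | inj₁ hv<1+m = inj₁ (from (upto-m v) (s≤s⁻¹ hv<1+m))
      ... | inj₂ hv≡1+m = inj₂ (from (layer-1+m v) hv≡1+m)

  layers-of-grading : ∀ m → LayerIsLevel m × UptoIsBelow m
  layers-of-grading zero =
    root , λ v → mk⇔ (λ Sv → ≤-reflexive (to (root v) Sv)) (λ hv≤0 → from (root v) (n≤0⇒n≡0 hv≤0))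
  layers-of-grading (suc m) =
    let (layer-m , upto-m) = layers-of-grading m
        layer-1+m = layer-step layer-m upto-m
    in layer-1+m , upto-step upto-m layer-1+m

module GradingOfLayers {n : ℕ} (G : Graph n) (S : Fin n → Set) (h : Fin n → ℕ)
                       (level-of-layer : ∀ i {v} → Layer G S i v → h v ≡ i)
                       (layer-of-level : ∀ v → Layer G S (h v) v) where
  open Layers G S

  upto-level : ∀ {m v} → Upto G S m v → h v ≤ m
  upto-level p with upto⇒layer p
  ... | i , i≤m , l = subst (_≤ _) (≡-sym (level-of-layer i l)) i≤m

  -- A neighbour v of u with a higher level is not reached by step h u, hence
  -- is reached at step h u + 1.
  lipschitz : Lipschitz G h
  lipschitz {u} {v} u—v with <-cmp (h u) (h v)
  ... | tri< hu<hv _ _ = ≤-reflexive (level-of-layer (suc (h u))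
                           ((λ old → <⇒≱ hu<hv (upto-level old)) , u , layer-of-level u , u—v))
  ... | tri≈ _ hu≡hv _ = m≤n⇒m≤1+n (≤-reflexive (≡-sym hu≡hv))
  ... | tri> _ _ hv<hu = ≤-trans (<⇒≤ hv<hu) (n≤1+n _)

  -- The vertex through which v was reached is a parent.
  parents : HasParents G h
  parents {v} {m} hv≡1+m with subst (λ i → Layer G S i v) hv≡1+m (layer-of-level v)
  ... | _ , u , u∈layer , u—v = u , u—v , level-of-layer m u∈layer

  grading-of-layers : Graded G h
  grading-of-layers = lipschitz , parents

module Partition {n k : ℕ} (blk : Fin n → Fin (suc k)) (G : Graph n) where

  S : Fin n → Set
  S v = blk v ≡ fzero

  level : Fin n → ℕ
  level v = toℕ (blk v)

  root : ∀ v → S v ⇔ level v ≡ 0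
  root v = mk⇔ (cong toℕ) toℕ-injective

  positive-not-root : ∀ {w m} → level w ≡ suc m → blk w ≢ fzero
  positive-not-root lw≡1+m w∈σ₁ = 0≢1+n (trans (≡-sym (cong toℕ w∈σ₁)) lw≡1+m)

  JEq⇔Graded : IsOrderedPartition blk → JEq G S blk ⇔ Graded G level
  JEq⇔Graded surj = mk⇔ graded-of-JEq JEq-of-graded
    where
      open Layers G S

      graded-of-JEq : JEq G S blk → Graded G level
      graded-of-JEq (layer⇔block , cover , _) = grading-of-layers
        where
          -- The level of a vertex is the index of its layer; this needs the
          -- process to have stopped after k+1 layers, so later layers are empty. after k+1 layers, so later layers are empty.
          layer-bounded : ∀ i {v} → Layer G S i v → i ≤ k
          layer-bounded zero _ = z≤n
          layer-bounded (suc m) {v} (new , _) with m <? k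
          ... | yes m<k = m<k
          ... | no m≮k = ⊥-elim (new (upto-mono (≤⇒≤′ (≮⇒≥ m≮k)) (cover v)))
          level-of-layer : ∀ i {v} → Layer G S i v → level v ≡ i
          level-of-layer i {v} l =
            trans (cong toℕ (to (layer⇔block (fromℕ< i<1+k) v)
                                (subst (λ x → Layer G S x v) (≡-sym (toℕ-fromℕ< i<1+k)) l)))
                  (toℕ-fromℕ< i<1+k)
            where i<1+k = s≤s (layer-bounded i l)
          open GradingOfLayers G S level level-of-layer (λ v → from (layer⇔block (blk v) v) refl)

      JEq-of-graded : Graded G level → JEq G S blk
      JEq-of-graded graded = layers-are-blocks , cover , no-early-stop
        where
          open LayersOfGrading G S level root graded
          layers-are-blocks : ∀ i v → Layer G S (toℕ i) v ⇔ blk v ≡ i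
          layers-are-blocks i v =
            mk⇔ toℕ-injective (cong toℕ) ⇔-∘ proj₁ (layers-of-grading (toℕ i)) v
          cover : ∀ v → Upto G S k v
          cover v = from (proj₂ (layers-of-grading k) v) (toℕ≤pred[n] (blk v))
          -- The last block σ_{k+1} is nonempty, so step m < k misses a vertex.
          no-early-stop : ∀ m → m < k → ¬ (∀ v → Upto G S m v)
          no-early-stop m m<k all with surj (fromℕ k)
          ... | v , v∈last = <⇒≱ m<k (subst (_≤ m) (trans (cong toℕ v∈last) (toℕ-fromℕ k))
                                               (to (proj₂ (layers-of-grading m) v) (all v)))

  CondII⇔Graded : CondII G blk ⇔ Graded G level
  CondII⇔Graded = mk⇔ graded-of-CondII CondII-of-graded
    where
      down-one : ∀ {w y} {j : Fin k} → blk w ≡ fsuc j → blk y ≡ inject₁ j → level w ≡ suc (level y)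
      down-one w∈σ y∈σ′ = trans (cong toℕ w∈σ) (cong suc (≡-sym (to ≡inject₁⇔toℕ y∈σ′)))

      graded-of-CondII : CondII G blk → Graded G level
      graded-of-CondII (A , B , edges⇔ , A-inside , B-down) = lipschitz , parents
        where
          B-close : ∀ {w u v} (j : Fin k) → blk w ≡ fsuc j → B w u v → Near (level u) (level v)
          B-close {w} {u} {v} j w∈σ b with proj₂ (B-down w j w∈σ) u v b
          ... | inj₁ (refl , v∈σ′) = one-apart (down-one w∈σ v∈σ′)
          ... | inj₂ (refl , u∈σ′) = swap (one-apart (down-one w∈σ u∈σ′))

          same-block-close : ∀ {i u v} → blk u ≡ i × blk v ≡ i → Near (level u) (level v)
          same-block-close (u∈σ , v∈σ) = equal-near (cong toℕ (trans u∈σ (≡-sym v∈σ)))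

          close : ∀ {u v} → Adj G u v → Near (level u) (level v)
          close {u} {v} u—v with to (edges⇔ u v) u—v
          ... | inj₁ (i , inj₁ a) = same-block-close (A-inside i u v a)
          ... | inj₁ (i , inj₂ a) = swap (same-block-close (A-inside i v u a))
          ... | inj₂ (w , w∉σ₁ , b) with Fin-nonzero (blk w) w∉σ₁
          ...   | j , w∈σ with b
          ...     | inj₁ b-uv = B-close j w∈σ b-uv
          ...     | inj₂ b-vu = swap (B-close j w∈σ b-vu)

          lipschitz : Lipschitz G level
          lipschitz u—v = proj₁ (close u—v)

          -- A nonempty B_w provides the parent of w.
          parents : HasParents G level
          parents {w} lw≡1+m with toℕ-suc (blk w) lw≡1+m
          ... | j , w∈σ , j≡m with B-down w j w∈σ
          ...   | (x , y , b) , orient with orient x y b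
                                         | from (edges⇔ x y) (inj₂ (w , positive-not-root lw≡1+m , inj₁ b))
          ...     | inj₁ (refl , y∈σ′) | x—y = y , sym G x—y , trans (to ≡inject₁⇔toℕ y∈σ′) j≡m
          ...     | inj₂ (refl , x∈σ′) | x—y = x , x—y , trans (to ≡inject₁⇔toℕ x∈σ′) j≡m

      CondII-of-graded : Graded G level → CondII G blk
      CondII-of-graded (lipschitz , parents) = A , B , edges⇔ , (λ i u v a → proj₂ a) , B-down
        where
          A : Fin (suc k) → EdgeSet n
          A i u v = Adj G u v × blk u ≡ i × blk v ≡ i
          B : Fin n → EdgeSet n
          B w u v = u ≡ w × Adj G u v × level w ≡ suc (level v)

          -- An edge between different levels goes exactly one level down from
          -- its upper end, by Lipschitz.
          classify : ∀ {u v} → Adj G u v →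
                     (∃[ i ] (A i ∋ₑ u — v)) ⊎ (∃[ w ] (blk w ≢ fzero × (B w ∋ₑ u — v)))
          classify {u} {v} u—v with <-cmp (level u) (level v)
          ... | tri≈ _ lu≡lv _ = inj₁ (blk u , inj₁ (u—v , refl , ≡-sym (toℕ-injective lu≡lv)))
          ... | tri< lu<lv _ _ = inj₂ (v , positive-not-root lv≡1+lu , inj₂ (refl , sym G u—v , lv≡1+lu))
            where lv≡1+lu = ≤-antisym (lipschitz u—v) lu<lv
          ... | tri> _ _ lv<lu = inj₂ (u , positive-not-root lu≡1+lv , inj₁ (refl , u—v , lu≡1+lv))
            where lu≡1+lv = ≤-antisym (lipschitz (sym G u—v)) lv<lu

          edge-of : ∀ {u v} → (∃[ i ] (A i ∋ₑ u — v)) ⊎ (∃[ w ] (blk w ≢ fzero × (B w ∋ₑ u — v))) →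
                    Adj G u v
          edge-of (inj₁ (_ , inj₁ (u—v , _))) = u—v
          edge-of (inj₁ (_ , inj₂ (v—u , _))) = sym G v—u
          edge-of (inj₂ (_ , _ , inj₁ (_ , u—v , _))) = u—v
          edge-of (inj₂ (_ , _ , inj₂ (_ , v—u , _))) = sym G v—u

          edges⇔ : ∀ u v → Adj G u v ⇔
                   ((∃[ i ] (A i ∋ₑ u — v)) ⊎ (∃[ w ] (blk w ≢ fzero × (B w ∋ₑ u — v))))
          edges⇔ u v = mk⇔ classify edge-of

          B-down : ∀ w (j : Fin k) → blk w ≡ fsuc j →
                   (∃[ u ] ∃[ v ] B w u v) ×
                   (∀ u v → B w u v → (u ≡ w × blk v ≡ inject₁ j) ⊎ (v ≡ w × blk u ≡ inject₁ j))
          B-down w j w∈σ = nonempty , (λ { u v (u≡w , _ , lw≡1+lv) → inj₁ (u≡w , from ≡inject₁⇔toℕ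
                                                (suc-injective (trans (≡-sym lw≡1+lv) (cong toℕ w∈σ)))) })
            where
              nonempty : ∃[ u ] ∃[ v ] B w u v
              nonempty with parents (cong toℕ w∈σ)
              ... | p , p—w , lp≡j = w , p , refl , sym G p—w , trans (cong toℕ w∈σ) (cong suc (≡-sym lp≡j))

proposition4p1 : {n k : ℕ} (blk : Fin n → Fin (suc k)) → IsOrderedPartition blk →
                 (G : Graph n) → Anchored G (λ v → blk v ≡ fzero) →
                 JEq G (λ v → blk v ≡ fzero) blk ⇔ CondII G blk
proposition4p1 blk surj G _ = ⇔-sym CondII⇔Graded ⇔-∘ JEq⇔Graded surj
  where open Partition blk G
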